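{- Let $n,s,\ell,c$ be positive integers with $n=2s+c=3s-\ell$ and $c,\ell\in\{1,\dots,s-1\}$, and let $\mathcal{F}\subset 2^{[n]}$. If $d(\mathcal{F})>0$ and $\nu(\mathcal{F})<s$, then $y_{\mathcal{F}}(3)\ge\binom{3c-1}{2}$. Moreover, equality is achieved only if $\mathcal{F}$ contains all sets in $\binom{[n]}{3}\setminus\binom{[2\ell+1,n]}{3}$.
   Context: $[m]=\{1,\dots,m\}$, $[a,b]=\{a,\dots,b\}$. $\nu(\mathcal{F})$ is the maximum number of pairwise disjoint members of $\mathcal{F}$. $y_{\mathcal{F}}(3)=\binom n3-|\mathcal{F}\cap\binom{[n]}{3}|$. $d(\mathcal{F})$ is the smallest integer $d\ge 0$ such that either ($d$ even and for some $i\in[1,\ell+\frac d2]$, $\{i,2\ell+d+1-i\}\notin\mathcal{F}$) or ($d$ odd and either $\{1,2\ell+d\}\notin\mathcal{F}$, or for some $i\in[3,\ell+\frac{d+1}{2}]$, $\{i,2\ell+d+2-i\}\notin\mathcal{F}$). -}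

module Defs where

open import Data.Nat using (ℕ; zero; suc; _+_; _*_; _∸_; _≤_; _<_; _≡ᵇ_; ⌊_/2⌋)
open import Data.Nat.DivMod using (_%_)
open import Data.Nat.Combinatorics using (_C_)
open import Data.Bool using (Bool; true; false; _∨_; T)
open import Data.Fin using (Fin; toℕ)
open import Data.Fin.Subset using (Subset; _∩_; ∣_∣; ⊥)
open import Data.Vec using (Vec; []; _∷_; tabulate)
open import Data.List using (List; []; _∷_; map; _++_; filter; length)
open import Data.Product using (Σ; ∃; ∃-syntax; _×_)
open import Data.Sum using (_⊎_)
open import Relation.Binary.PropositionalEquality using (_≡_; _≢_)
open import Relation.Nullary using (¬_)
open import Function.Definitions using (Injective)

-- Elements of [n] = {1,…,n} are represented by Fin n, where k : Fin n
-- stands for the integer  toℕ k + 1.  A family 𝓕 ⊆ 2^[n] is a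
-- (decidable) predicate  Subset n → Bool.

Family : ℕ → Set
Family n = Subset n → Bool

allSubsets : ∀ n → List (Subset n)
allSubsets zero    = [] ∷ []
allSubsets (suc n) = map (true ∷_) (allSubsets n) ++ map (false ∷_) (allSubsets n)

threeSets : ∀ n → List (Subset n)
threeSets n = filter (λ A → ∣ A ∣ Data.Nat.≟ 3) (allSubsets n)

y3 : ∀ {n} → Family n → ℕ
y3 {n} F = (n C 3) ∸ length (filter (λ A → T? (F A)) (threeSets n))
  where
  T? : (b : Bool) → Relation.Nullary.Dec (T b)
  T? = Data.Bool.T?

-- ν(𝓕) ≥ k : there are k pairwise distinct, pairwise disjoint members of 𝓕
HasDisjoint : ∀ {n} → Family n → ℕ → Set
HasDisjoint {n} F k =
  Σ (Fin k → Subset n) λ A →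
    Injective _≡_ _≡_ A ×
    (∀ i → F (A i) ≡ true) ×
    (∀ i j → i ≢ j → A i ∩ A j ≡ ⊥)

νLess : ∀ {n} → Family n → ℕ → Set
νLess F s = ¬ HasDisjoint F s

pair : ∀ {n} → ℕ → ℕ → Subset n
pair a b = tabulate (λ k → (suc (toℕ k) ≡ᵇ a) ∨ (suc (toℕ k) ≡ᵇ b))

-- {a, b} ∈ 𝓕  (requires 1 ≤ a, b ≤ n, so that {a,b} is a subset of [n])
PairIn : ∀ {n} → Family n → ℕ → ℕ → Set
PairIn {n} F a b = 1 ≤ a × a ≤ n × 1 ≤ b × b ≤ n × F (pair a b) ≡ true

DCond : ∀ {n} → ℕ → Family n → ℕ → Set
DCond ℓ F d =
    (d % 2 ≡ 0 ×
      ∃[ i ] (1 ≤ i × i ≤ ℓ + ⌊ d /2⌋ × ¬ PairIn F i (2 * ℓ + d + 1 ∸ i)))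
  ⊎ (d % 2 ≡ 1 ×
      (¬ PairIn F 1 (2 * ℓ + d)
       ⊎ ∃[ i ] (3 ≤ i × i ≤ ℓ + ⌊ (d + 1) /2⌋ × ¬ PairIn F i (2 * ℓ + d + 2 ∸ i))))

IsD : ∀ {n} → ℕ → Family n → ℕ → Set
IsD ℓ F d = DCond ℓ F d × (∀ d′ → d′ < d → ¬ DCond ℓ F d′)

-- A ⊆ [2ℓ+1, n]  (every element k, i.e. integer toℕ k + 1, is ≥ 2ℓ+1)
InTail : ∀ {n} → ℕ → Subset n → Set
InTail {n} ℓ A = ∀ (k : Fin n) → Data.Vec.lookup A k ≡ true → 2 * ℓ ≤ toℕ k

Is3 : ∀ {n} → Subset n → Set
Is3 A = ∣ A ∣ ≡ 3

module Submission where

open import Defs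
open import Data.Bool using (Bool; true; false; _∨_; if_then_else_; T?)
open import Data.Bool.Properties using (T-≡; T-∨) renaming (_≟_ to _≟ᵇ_)
open import Data.Empty using (⊥-elim)
open import Data.Fin using (Fin; toℕ; fromℕ<; splitAt; join) renaming (zero to fzero; suc to fsuc)
open import Data.Fin.Properties using (toℕ-injective; toℕ-fromℕ<; toℕ<n; join-splitAt; all?) renaming (_≟_ to _≟ᶠ_)
open import Data.Fin.Subset using (Subset; ⁅_⁆; _∪_; _∩_; ⊥; ∣_∣; Nonempty; inside; outside) renaming (_∈_ to _∈ₛ_; _∉_ to _∉ₛ_)
open import Data.Fin.Subset.Properties using (x∈p∪q⁻; x∈p∪q⁺; x∈⁅y⁆⇒x≡y; x∈⁅x⁆; ∉⊥; ∪-identityˡ; Empty-unique; x∈p∩q⁻; x∈p∩q⁺)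
open import Data.List using (List; []; _∷_; map; _++_; filter; length; allFin; drop)
open import Data.List.Properties using (map-++; map-∘; map-tabulate; length-filter; length-tabulate; drop-map; length-drop)
open import Data.List.Membership.Propositional using (_∈_; _∉_)
open import Data.List.Membership.Propositional.Properties using (∈-map⁺; ∈-map⁻; ∈-++⁺ˡ; ∈-++⁺ʳ; ∈-filter⁺)
open import Data.List.Relation.Binary.Pointwise using (≡⇒Pointwise-≡)
open import Data.List.Relation.Binary.Sublist.Propositional using (_⊆_; []; _∷_; _∷ʳ_; minimum; ⊆-refl)
open import Data.List.Relation.Binary.Sublist.Propositional.Properties using (drop-⊆; Any-resp-⊆)
import Data.List.Relation.Ternary.Interleaving.Propositional as Interleaving
open import Data.List.Relation.Ternary.Interleaving.Properties using (interleave-length)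
import Data.List.Relation.Unary.All as All
open import Data.List.Relation.Unary.AllPairs using ([]; _∷_)
open import Data.List.Relation.Unary.Any using (here; there)
import Data.List.Relation.Unary.Unique.Propositional as Unique
open import Data.List.Relation.Unary.Unique.Propositional.Properties using (Unique[x∷xs]⇒x∉xs; drop⁺; allFin⁺)
open import Data.Nat using (ℕ; zero; suc; _+_; _*_; _∸_; _≤_; _<_; _≥_; z≤n; s≤s; z<s; _≡ᵇ_; _≤?_; _≟_; >-nonZero)
open import Data.Nat.Combinatorics using (_C_; nC1≡n; nCk+nC[k+1]≡[n+1]C[k+1])
open import Data.Nat.ListAction using (sum)
open import Data.Nat.ListAction.Properties using (sum-++)
open import Data.Nat.Properties
open import Algebra.Properties.CommutativeSemigroup +-commutativeSemigroup using (interchange)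
open import Data.Nat.Tactic.RingSolver using (solve-∀)
open import Data.Product using (∃-syntax; _×_; _,_)
open import Data.Sum using (_⊎_; inj₁; inj₂) renaming (map to ⊎-map)
open import Data.Vec using ([]; _∷_; lookup)
open import Data.Vec.Properties using (lookup∘tabulate; []=⇒lookup; lookup⇒[]=)
open import Function using (_∘_; Equivalence)
open import Function.Definitions using (Injective)
open import Relation.Binary.PropositionalEquality using (_≡_; _≢_; refl; sym; trans; cong; cong₂; subst; module ≡-Reasoning)
open import Relation.Nullary using (¬_; Dec; yes; no; does)
open import Relation.Nullary.Decidable using (_→-dec_; dec-true; dec-false)
open import Relation.Unary using (Decidable)

-- Since d(𝓕) > 0, 𝓕 contains the ℓ pairs {i, 2ℓ+1−i} partitioning [2ℓ]; as ν(𝓕) < s = ℓ + c, the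
-- 3c-element tail [2ℓ+1, n] contains no c pairwise disjoint members of 𝓕. Such a 3c-set misses at
-- least C(3c−1, 2) of its triples, by induction on c: fix a vertex v and let K = C(3c−4, 2). For
-- each pair P of the other 3c−1 vertices, either P ∪ {v} is missing, or the remaining 3c−3
-- vertices contain no c−1 disjoint members of 𝓕 and so miss at least K triples. Summing over the
-- C(3c−1, 2) pairs, and noting that a triple avoiding v is counted for exactly K pairs, gives
-- K · (missing triples) ≥ K · C(3c−1, 2). Every triple counted lies in the tail, so a missing
-- triple meeting [2ℓ] makes the inequality strict.

private variable
  A B : Set

module _ {X : Set} where

  open Interleaving {A = X} using (Interleaving; []; consˡ; consʳ; right)
  open Unique {A = X} using (Unique)

  sumChoose : ℕ → List X → (List X → ℕ) → ℕ
  sumChoose zero    W       g = g []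
  sumChoose (suc k) []      g = 0
  sumChoose (suc k) (w ∷ W) g = sumChoose k W (λ T → g (w ∷ T)) + sumChoose (suc k) W g

  sumSplits : ℕ → List X → (List X → List X → ℕ) → ℕ
  sumSplits zero    W       h = h [] W
  sumSplits (suc k) []      h = 0
  sumSplits (suc k) (w ∷ W) h =
    sumSplits k W (λ P R → h (w ∷ P) R) + sumSplits (suc k) W (λ P R → h P (w ∷ R))

  sumSplits-+ : ∀ k W (h₁ h₂ : List X → List X → ℕ) →
    sumSplits k W (λ P R → h₁ P R + h₂ P R) ≡ sumSplits k W h₁ + sumSplits k W h₂
  sumSplits-+ zero    W       h₁ h₂ = refl
  sumSplits-+ (suc k) []      h₁ h₂ = refl
  sumSplits-+ (suc k) (w ∷ W) h₁ h₂ = trans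
    (cong₂ _+_ (sumSplits-+ k W h₁ʷ h₂ʷ) (sumSplits-+ (suc k) W h₁ʳ h₂ʳ))
    (interchange (sumSplits k W h₁ʷ) (sumSplits k W h₂ʷ) (sumSplits (suc k) W h₁ʳ) (sumSplits (suc k) W h₂ʳ))
    where
    h₁ʷ h₂ʷ h₁ʳ h₂ʳ : List X → List X → ℕ
    h₁ʷ P R = h₁ (w ∷ P) R
    h₂ʷ P R = h₂ (w ∷ P) R
    h₁ʳ P R = h₁ P (w ∷ R)
    h₂ʳ P R = h₂ P (w ∷ R)

  sumSplits-* : ∀ k W m (h : List X → List X → ℕ) →
    sumSplits k W (λ P R → m * h P R) ≡ m * sumSplits k W h
  sumSplits-* zero    W       m h = refl
  sumSplits-* (suc k) []      m h = sym (*-zeroʳ m)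
  sumSplits-* (suc k) (w ∷ W) m h
    rewrite sumSplits-* k W m (λ P R → h (w ∷ P) R)
          | sumSplits-* (suc k) W m (λ P R → h P (w ∷ R))
    = sym (*-distribˡ-+ m _ _)

  sumSplits-const : ∀ k W m → sumSplits k W (λ _ _ → m) ≡ (length W C k) * m
  sumSplits-const zero    W       m = sym (+-identityʳ m)
  sumSplits-const (suc k) []      m = refl
  sumSplits-const (suc k) (w ∷ W) m
    rewrite sumSplits-const k W m | sumSplits-const (suc k) W m
    = trans (sym (*-distribʳ-+ m (length W C k) _)) (cong (_* m) (nCk+nC[k+1]≡[n+1]C[k+1] (length W) k))

  sumSplits-ignoreʳ : ∀ k W (f : List X → ℕ) → sumSplits k W (λ P _ → f P) ≡ sumChoose k W f
  sumSplits-ignoreʳ zero    W       f = refl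
  sumSplits-ignoreʳ (suc k) []      f = refl
  sumSplits-ignoreʳ (suc k) (w ∷ W) f
    rewrite sumSplits-ignoreʳ k W (λ P → f (w ∷ P)) | sumSplits-ignoreʳ (suc k) W f = refl

  sumChoose-const : ∀ k W m → sumChoose k W (λ _ → m) ≡ (length W C k) * m
  sumChoose-const k W m = trans (sym (sumSplits-ignoreʳ k W (λ _ → m))) (sumSplits-const k W m)

  sumChoose-short : ∀ k W g → length W < k → sumChoose k W g ≡ 0
  sumChoose-short (suc k) []      g _           = refl
  sumChoose-short (suc k) (w ∷ W) g (s≤s |W|<k)
    rewrite sumChoose-short k W (λ T → g (w ∷ T)) |W|<k
          | sumChoose-short (suc k) W g (m<n⇒m<1+n |W|<k) = refl

  sumSplits-mono : ∀ k W (h₁ h₂ : List X → List X → ℕ) →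
    (∀ {P R} → Interleaving P R W → length P ≡ k → h₁ P R ≤ h₂ P R) →
    sumSplits k W h₁ ≤ sumSplits k W h₂
  sumSplits-mono zero    W       h₁ h₂ h₁≤h₂ = h₁≤h₂ (right (≡⇒Pointwise-≡ refl)) refl
  sumSplits-mono (suc k) []      h₁ h₂ h₁≤h₂ = z≤n
  sumSplits-mono (suc k) (w ∷ W) h₁ h₂ h₁≤h₂ = +-mono-≤
    (sumSplits-mono k W _ _ (λ s |P|≡k → h₁≤h₂ (consˡ s) (cong suc |P|≡k)))
    (sumSplits-mono (suc k) W _ _ (λ s |P|≡k → h₁≤h₂ (consʳ s) |P|≡k))

  -- Double counting: a j-split (P, R) of W followed by an i-subset of R is an i-subset T of W
  -- followed by a j-subset of the r elements outside T.
  sumSplits-sumChoose : ∀ j i W r g → length W ≡ i + r →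
    sumSplits j W (λ _ R → sumChoose i R g) ≡ (r C j) * sumChoose i W g
  sumSplits-sumChoose zero    i       W       r       g _     = sym (+-identityʳ _)
  sumSplits-sumChoose (suc j) zero    W       r       g |W|≡r =
    trans (sumSplits-const (suc j) W (g [])) (cong (λ m → (m C suc j) * g []) |W|≡r)
  sumSplits-sumChoose (suc j) (suc i) W       zero    g |W|≡i =
    trans (n≤0⇒n≡0 (begin
      sumSplits (suc j) W (λ _ R → sumChoose (suc i) R g) ≤⟨ sumSplits-mono (suc j) W _ _ vanishes ⟩
      sumSplits (suc j) W (λ _ _ → 0)                     ≡⟨ sumSplits-const (suc j) W 0 ⟩
      (length W C suc j) * 0                              ≡⟨ *-zeroʳ (length W C suc j) ⟩
      0                                                   ∎))
      (sym (*-zeroˡ (sumChoose (suc i) W g)))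
    where
    open ≤-Reasoning
    vanishes : ∀ {P R} → Interleaving P R W → length P ≡ suc j → sumChoose (suc i) R g ≤ 0
    vanishes {P} {R} s |P|≡1+j = ≤-reflexive (sumChoose-short (suc i) R g (begin-strict
      length R              <⟨ m<n+m (length R) (subst (0 <_) (sym |P|≡1+j) z<s) ⟩
      length P + length R   ≡⟨ interleave-length s ⟨
      length W              ≡⟨ |W|≡i ⟩
      suc i + 0             ≡⟨ +-identityʳ (suc i) ⟩
      suc i                 ∎))
  sumSplits-sumChoose (suc j) (suc i) (w ∷ W) (suc r) g |w∷W| = begin
    sumSplits j W (λ _ R → sumChoose (suc i) R g)
      + sumSplits (suc j) W (λ _ R → sumChoose i R gʷ + sumChoose (suc i) R g)
      ≡⟨ cong (sumSplits j W (λ _ R → sumChoose (suc i) R g) +_)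
              (sumSplits-+ (suc j) W (λ _ R → sumChoose i R gʷ) (λ _ R → sumChoose (suc i) R g)) ⟩
    sumSplits j W (λ _ R → sumChoose (suc i) R g)
      + (sumSplits (suc j) W (λ _ R → sumChoose i R gʷ) + sumSplits (suc j) W (λ _ R → sumChoose (suc i) R g))
      ≡⟨ cong₂ _+_ (sumSplits-sumChoose j (suc i) W r g |W|≡1+i+r)
                   (cong₂ _+_ (sumSplits-sumChoose (suc j) i W (suc r) gʷ |W|≡i+1+r)
                              (sumSplits-sumChoose (suc j) (suc i) W r g |W|≡1+i+r)) ⟩
    (r C j) * Σ⁻ + ((suc r C suc j) * Σʷ + (r C suc j) * Σ⁻)
      ≡⟨ cong (λ m → (r C j) * Σ⁻ + (m * Σʷ + (r C suc j) * Σ⁻)) (nCk+nC[k+1]≡[n+1]C[k+1] r j) ⟨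
    (r C j) * Σ⁻ + ((r C j + r C suc j) * Σʷ + (r C suc j) * Σ⁻)
      ≡⟨ regroup (r C j) (r C suc j) Σʷ Σ⁻ ⟩
    (r C j + r C suc j) * (Σʷ + Σ⁻)
      ≡⟨ cong (_* (Σʷ + Σ⁻)) (nCk+nC[k+1]≡[n+1]C[k+1] r j) ⟩
    (suc r C suc j) * (Σʷ + Σ⁻) ∎
    where
    open ≡-Reasoning
    gʷ = λ T → g (w ∷ T)
    Σʷ = sumChoose i W gʷ
    Σ⁻ = sumChoose (suc i) W g
    |W|≡i+1+r : length W ≡ i + suc r
    |W|≡i+1+r = suc-injective |w∷W|
    |W|≡1+i+r : length W ≡ suc i + r
    |W|≡1+i+r = trans |W|≡i+1+r (+-suc i r)
    regroup : ∀ a b x y → a * y + ((a + b) * x + b * y) ≡ (a + b) * (x + y)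
    regroup = solve-∀

  sumChoose-vertex-bound : ∀ j r v W (g : List X → ℕ) → length W ≡ suc j + r → 0 < r C j →
    (∀ {P R} → Interleaving P R W → length P ≡ j → r C j ≤ (r C j) * g (v ∷ P) + sumChoose (suc j) R g) →
    length W C j ≤ sumChoose (suc j) (v ∷ W) g
  sumChoose-vertex-bound j r v W g |W|≡ K>0 bound = *-cancelˡ-≤ K {{>-nonZero K>0}} (begin
    K * (length W C j)                                             ≡⟨ *-comm K _ ⟩
    (length W C j) * K                                             ≡⟨ sumSplits-const j W K ⟨
    sumSplits j W (λ _ _ → K)                                      ≤⟨ sumSplits-mono j W _ _ bound ⟩
    sumSplits j W (λ P R → K * g (v ∷ P) + sumChoose (suc j) R g)  ≡⟨ sumSplits-+ j W _ _ ⟩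
    sumSplits j W (λ P _ → K * g (v ∷ P)) + sumSplits j W (λ _ R → sumChoose (suc j) R g)
      ≡⟨ cong₂ _+_ (trans (sumSplits-* j W K _) (cong (K *_) (sumSplits-ignoreʳ j W _)))
                   (sumSplits-sumChoose j (suc j) W r g |W|≡) ⟩
    K * sumChoose j W (λ T → g (v ∷ T)) + K * sumChoose (suc j) W g ≡⟨ *-distribˡ-+ K _ _ ⟨
    K * sumChoose (suc j) (v ∷ W) g                                ∎)
    where
    open ≤-Reasoning
    K = r C j

  sumChoose-mono : ∀ k {V W} (g h : List X → ℕ) → V ⊆ W → (∀ {T} → T ⊆ V → g T ≤ h T) →
    sumChoose k V g ≤ sumChoose k W h
  sumChoose-mono zero    g h _  g≤h = g≤h (minimum _)
  sumChoose-mono (suc k) g h [] g≤h = z≤n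
  sumChoose-mono (suc k) {V} {w ∷ W} g h (.w ∷ʳ V⊆W) g≤h =
    ≤-trans (sumChoose-mono (suc k) g h V⊆W g≤h) (m≤n+m _ (sumChoose k W (λ T → h (w ∷ T))))
  sumChoose-mono (suc k) g h (refl ∷ V⊆W) g≤h = +-mono-≤
    (sumChoose-mono k _ _ V⊆W (λ T⊆V → g≤h (refl ∷ T⊆V)))
    (sumChoose-mono (suc k) g h V⊆W (λ T⊆V → g≤h (_ ∷ʳ T⊆V)))

  sumChoose-cong : ∀ k W (g h : List X → ℕ) → (∀ T → g T ≡ h T) → sumChoose k W g ≡ sumChoose k W h
  sumChoose-cong k W g h g≗h = ≤-antisym
    (sumChoose-mono k g h ⊆-refl (λ {T} _ → ≤-reflexive (g≗h T)))
    (sumChoose-mono k h g ⊆-refl (λ {T} _ → ≤-reflexive (sym (g≗h T))))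

  ∈-interleavingˡ : ∀ {P R W x} → Interleaving P R W → x ∈ P → x ∈ W
  ∈-interleavingˡ (consˡ s) (here x≡w)  = here x≡w
  ∈-interleavingˡ (consˡ s) (there x∈P) = there (∈-interleavingˡ s x∈P)
  ∈-interleavingˡ (consʳ s) x∈P         = there (∈-interleavingˡ s x∈P)

  ∈-interleavingʳ : ∀ {P R W x} → Interleaving P R W → x ∈ R → x ∈ W
  ∈-interleavingʳ (consʳ s) (here x≡w)  = here x≡w
  ∈-interleavingʳ (consʳ s) (there x∈R) = there (∈-interleavingʳ s x∈R)
  ∈-interleavingʳ (consˡ s) x∈R         = there (∈-interleavingʳ s x∈R)

  unique-interleavingʳ : ∀ {P R W} → Interleaving P R W → Unique W → Unique R
  unique-interleavingʳ []        []          = []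
  unique-interleavingʳ (consˡ s) (_ ∷ W!)    = unique-interleavingʳ s W!
  unique-interleavingʳ (consʳ s) (w∉W ∷ W!) =
    All.tabulate (λ x∈R → All.lookup w∉W (∈-interleavingʳ s x∈R)) ∷ unique-interleavingʳ s W!

  disjoint-interleaving : ∀ {P R W x} → Interleaving P R W → Unique W → x ∈ P → x ∉ R
  disjoint-interleaving (consˡ s) W!@(_ ∷ _) (here refl) x∈R =
    Unique[x∷xs]⇒x∉xs W! (∈-interleavingʳ s x∈R)
  disjoint-interleaving (consˡ s) (_ ∷ W!) (there x∈P) x∈R = disjoint-interleaving s W! x∈P x∈R
  disjoint-interleaving (consʳ s) W!@(_ ∷ _) x∈P (here refl) =
    Unique[x∷xs]⇒x∉xs W! (∈-interleavingˡ s x∈P)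
  disjoint-interleaving (consʳ s) (_ ∷ W!) x∈P (there x∈R) = disjoint-interleaving s W! x∈P x∈R

sumChoose-map : ∀ k (f : A → B) E (g : List B → ℕ) → sumChoose k (map f E) g ≡ sumChoose k E (g ∘ map f)
sumChoose-map zero    f E       g = refl
sumChoose-map (suc k) f []      g = refl
sumChoose-map (suc k) f (x ∷ E) g =
  cong₂ _+_ (sumChoose-map k f E (λ T → g (f x ∷ T))) (sumChoose-map (suc k) f E g)

sumBy : (A → ℕ) → List A → ℕ
sumBy g L = sum (map g L)

sumBy-++ : ∀ (g : A → ℕ) L M → sumBy g (L ++ M) ≡ sumBy g L + sumBy g M
sumBy-++ g L M = trans (cong sum (map-++ g L M)) (sum-++ (map g L) (map g M))

sumBy-map : ∀ (g : A → ℕ) (f : B → A) L → sumBy g (map f L) ≡ sumBy (g ∘ f) L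
sumBy-map g f L = cong sum (sym (map-∘ L))

sumBy-filter : ∀ {P : A → Set} (P? : Decidable P) (g : A → ℕ) L →
  sumBy g (filter P? L) ≡ sumBy (λ x → if does (P? x) then g x else 0) L
sumBy-filter P? g []      = refl
sumBy-filter P? g (x ∷ L) with does (P? x)
... | true  = cong (g x +_) (sumBy-filter P? g L)
... | false = sumBy-filter P? g L

sumBy-zero : ∀ (L : List A) → sumBy (λ _ → 0) L ≡ 0
sumBy-zero []      = refl
sumBy-zero (x ∷ L) = sumBy-zero L

sumBy-one : ∀ (L : List A) → sumBy (λ _ → 1) L ≡ length L
sumBy-one []      = refl
sumBy-one (x ∷ L) = cong suc (sumBy-one L)

sumBy-mono : ∀ (f g : A → ℕ) L → (∀ x → f x ≤ g x) → sumBy f L ≤ sumBy g L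
sumBy-mono f g []      f≤g = z≤n
sumBy-mono f g (x ∷ L) f≤g = +-mono-≤ (f≤g x) (sumBy-mono f g L f≤g)

sumBy-mono-< : ∀ (f g : A → ℕ) {L x} → x ∈ L → (∀ y → f y ≤ g y) → f x < g x → sumBy f L < sumBy g L
sumBy-mono-< f g {y ∷ L} (here refl)  f≤g fx<gx = +-mono-<-≤ fx<gx (sumBy-mono f g L f≤g)
sumBy-mono-< f g {y ∷ L} (there x∈L) f≤g fx<gx = +-mono-≤-< (f≤g y) (sumBy-mono-< f g x∈L f≤g fx<gx)

length-reject : ∀ (b : A → Bool) L → length L ∸ length (filter (T? ∘ b) L) ≡ sumBy (λ x → if b x then 0 else 1) L
length-reject b []      = refl
length-reject b (x ∷ L) with b x
... | true  = length-reject b L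
... | false = trans (+-∸-assoc 1 (length-filter (T? ∘ b) L)) (cong suc (length-reject b L))

module _ {n : ℕ} where

  fromList : List (Fin n) → Subset n
  fromList []      = ⊥
  fromList (x ∷ L) = ⁅ x ⁆ ∪ fromList L

  ∈-fromList⁺ : ∀ {x L} → x ∈ L → x ∈ₛ fromList L
  ∈-fromList⁺ {L = y ∷ L} (here refl)  = x∈p∪q⁺ (inj₁ (x∈⁅x⁆ y))
  ∈-fromList⁺ {L = y ∷ L} (there x∈L) = x∈p∪q⁺ (inj₂ (∈-fromList⁺ x∈L))

  ∈-fromList⁻ : ∀ {x} L → x ∈ₛ fromList L → x ∈ L
  ∈-fromList⁻ []      x∈⊥ = ⊥-elim (∉⊥ x∈⊥)
  ∈-fromList⁻ (y ∷ L) x∈  with x∈p∪q⁻ ⁅ y ⁆ (fromList L) x∈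
  ... | inj₁ x∈⁅y⁆ = here (x∈⁅y⁆⇒x≡y y x∈⁅y⁆)
  ... | inj₂ x∈L   = there (∈-fromList⁻ L x∈L)

fromList-map-suc : ∀ {n} (T : List (Fin n)) → fromList (map fsuc T) ≡ outside ∷ fromList T
fromList-map-suc []      = refl
fromList-map-suc (x ∷ T) = cong (⁅ fsuc x ⁆ ∪_) (fromList-map-suc T)

fromList-zero∷map-suc : ∀ {n} (T : List (Fin n)) → fromList (fzero ∷ map fsuc T) ≡ inside ∷ fromList T
fromList-zero∷map-suc T = trans (cong (⁅ fzero ⁆ ∪_) (fromList-map-suc T)) (cong (inside ∷_) (∪-identityˡ (fromList T)))

allFin-suc : ∀ n → allFin (suc n) ≡ fzero ∷ map fsuc (allFin n)
allFin-suc n = cong (fzero ∷_) (sym (map-tabulate (λ i → i) fsuc))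

sumBy-allSubsets : ∀ n k (g : Subset n → ℕ) →
  sumBy (λ B → if ∣ B ∣ ≡ᵇ k then g B else 0) (allSubsets n) ≡ sumChoose k (allFin n) (g ∘ fromList)
sumBy-allSubsets zero    zero    g = +-identityʳ (g [])
sumBy-allSubsets zero    (suc k) g = refl
sumBy-allSubsets (suc n) k       g = begin
  sumBy h (map (inside ∷_) (allSubsets n) ++ map (outside ∷_) (allSubsets n))
    ≡⟨ sumBy-++ h (map (inside ∷_) (allSubsets n)) _ ⟩
  sumBy h (map (inside ∷_) (allSubsets n)) + sumBy h (map (outside ∷_) (allSubsets n))
    ≡⟨ cong₂ _+_ (sumBy-map h (inside ∷_) (allSubsets n)) (sumBy-map h (outside ∷_) (allSubsets n)) ⟩
  sumBy (h ∘ (inside ∷_)) (allSubsets n) + sumBy (h ∘ (outside ∷_)) (allSubsets n)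
    ≡⟨ cong₂ _+_ (withInside k) (sumBy-allSubsets n k (g ∘ (outside ∷_))) ⟩
  insideTerms k + sumChoose k (allFin n) (λ T → g (outside ∷ fromList T))
    ≡⟨ split k ⟩
  sumChoose k (fzero ∷ map fsuc (allFin n)) (g ∘ fromList)
    ≡⟨ cong (λ W → sumChoose k W (g ∘ fromList)) (allFin-suc n) ⟨
  sumChoose k (allFin (suc n)) (g ∘ fromList) ∎
  where
  open ≡-Reasoning
  h : Subset (suc n) → ℕ
  h B = if ∣ B ∣ ≡ᵇ k then g B else 0
  insideTerms : ℕ → ℕ
  insideTerms zero    = 0
  insideTerms (suc k) = sumChoose k (allFin n) (λ T → g (inside ∷ fromList T))
  withInside : ∀ k → sumBy (λ B → if suc ∣ B ∣ ≡ᵇ k then g (inside ∷ B) else 0) (allSubsets n) ≡ insideTerms k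
  withInside zero    = sumBy-zero (allSubsets n)
  withInside (suc k) = sumBy-allSubsets n k (g ∘ (inside ∷_))
  split : ∀ k → insideTerms k + sumChoose k (allFin n) (λ T → g (outside ∷ fromList T))
              ≡ sumChoose k (fzero ∷ map fsuc (allFin n)) (g ∘ fromList)
  split zero    = refl
  split (suc k) = sym (cong₂ _+_
    (trans (sumChoose-map k fsuc (allFin n) _) (sumChoose-cong k (allFin n) _ _ (cong g ∘ fromList-zero∷map-suc)))
    (trans (sumChoose-map (suc k) fsuc (allFin n) _) (sumChoose-cong (suc k) (allFin n) _ _ (cong g ∘ fromList-map-suc))))

sumBy-threeSets : ∀ n (g : Subset n → ℕ) → sumBy g (threeSets n) ≡ sumChoose 3 (allFin n) (g ∘ fromList)
sumBy-threeSets n g = trans (sumBy-filter (λ B → ∣ B ∣ ≟ 3) g (allSubsets n)) (sumBy-allSubsets n 3 g)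

length-threeSets : ∀ n → length (threeSets n) ≡ n C 3
length-threeSets n = begin
  length (threeSets n)                  ≡⟨ sumBy-one (threeSets n) ⟨
  sumBy (λ _ → 1) (threeSets n)         ≡⟨ sumBy-threeSets n (λ _ → 1) ⟩
  sumChoose 3 (allFin n) (λ _ → 1)      ≡⟨ sumChoose-const 3 (allFin n) 1 ⟩
  (length (allFin n) C 3) * 1           ≡⟨ *-identityʳ _ ⟩
  length (allFin n) C 3                 ≡⟨ cong (_C 3) (length-tabulate {n = n} (λ i → i)) ⟩
  n C 3                                 ∎
  where open ≡-Reasoning

∈-allSubsets : ∀ {n} (B : Subset n) → B ∈ allSubsets n
∈-allSubsets []                    = here refl
∈-allSubsets (inside ∷ B)          = ∈-++⁺ˡ (∈-map⁺ (inside ∷_) (∈-allSubsets B))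
∈-allSubsets {suc n} (outside ∷ B) =
  ∈-++⁺ʳ (map (inside ∷_) (allSubsets n)) (∈-map⁺ (outside ∷_) (∈-allSubsets B))

missing : ∀ {n} → Family n → Subset n → ℕ
missing F B = if F B then 0 else 1

y3≡sumBy : ∀ {n} (F : Family n) → y3 F ≡ sumBy (missing F) (threeSets n)
y3≡sumBy {n} F = begin
  n C 3 ∸ length (filter (T? ∘ F) (threeSets n))
    ≡⟨ cong (_∸ length (filter (T? ∘ F) (threeSets n))) (length-threeSets n) ⟨
  length (threeSets n) ∸ length (filter (T? ∘ F) (threeSets n))
    ≡⟨ length-reject F (threeSets n) ⟩
  sumBy (missing F) (threeSets n) ∎
  where open ≡-Reasoning

∩≡⊥ : ∀ {n} {p q : Subset n} → (∀ {x} → x ∈ₛ p → x ∉ₛ q) → p ∩ q ≡ ⊥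
∩≡⊥ {p = p} {q} p#q = Empty-unique (λ (_ , x∈p∩q) → let x∈p , x∈q = x∈p∩q⁻ p q x∈p∩q in p#q x∈p x∈q)

record Packing {n} (F : Family n) (G : Fin n → Set) (c : ℕ) : Set where
  field
    member   : Fin c → Subset n
    member∈F : ∀ i → F (member i) ≡ true
    nonempty : ∀ i → Nonempty (member i)
    disjoint : ∀ i j → i ≢ j → member i ∩ member j ≡ ⊥
    ⊆ground  : ∀ i {x} → x ∈ₛ member i → G x

module _ {n} {F : Family n} where

  packing-singleton : ∀ {A} → F A ≡ true → Nonempty A → Packing F (_∈ₛ A) 1
  packing-singleton {A} A∈F A≢∅ = record
    { member   = λ _ → A
    ; member∈F = λ _ → A∈F
    ; nonempty = λ _ → A≢∅
    ; disjoint = λ { fzero fzero 0≢0 → ⊥-elim (0≢0 refl) }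
    ; ⊆ground  = λ _ x∈A → x∈A
    }

  packing-weaken : ∀ {G H c} → (∀ {x} → G x → H x) → Packing F G c → Packing F H c
  packing-weaken G⊆H 𝓟 = record { Packing 𝓟; ⊆ground = λ i x∈ → G⊆H (Packing.⊆ground 𝓟 i x∈) }

  packing-++ : ∀ {G H a b} → Packing F G a → Packing F H b → (∀ {x} → G x → ¬ H x) →
               Packing F (λ x → G x ⊎ H x) (a + b)
  packing-++ {G} {H} {a} {b} 𝓟 𝓠 G#H = record
    { member   = λ i → member (splitAt a i)
    ; member∈F = λ i → member∈F (splitAt a i)
    ; nonempty = λ i → nonempty (splitAt a i)
    ; disjoint = λ i j i≢j → disjoint (splitAt a i) (splitAt a j) (λ eq → i≢j (splitAt-injective eq))
    ; ⊆ground  = λ i → ⊆ground (splitAt a i)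
    }
    where
    module P = Packing 𝓟
    module Q = Packing 𝓠
    member : Fin a ⊎ Fin b → Subset n
    member (inj₁ i) = P.member i
    member (inj₂ j) = Q.member j
    member∈F : ∀ u → F (member u) ≡ true
    member∈F (inj₁ i) = P.member∈F i
    member∈F (inj₂ j) = Q.member∈F j
    nonempty : ∀ u → Nonempty (member u)
    nonempty (inj₁ i) = P.nonempty i
    nonempty (inj₂ j) = Q.nonempty j
    ⊆ground : ∀ u {x} → x ∈ₛ member u → G x ⊎ H x
    ⊆ground (inj₁ i) x∈ = inj₁ (P.⊆ground i x∈)
    ⊆ground (inj₂ j) x∈ = inj₂ (Q.⊆ground j x∈)
    disjoint : ∀ u v → u ≢ v → member u ∩ member v ≡ ⊥
    disjoint (inj₁ i) (inj₁ i′) u≢v = P.disjoint i i′ (λ eq → u≢v (cong inj₁ eq))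
    disjoint (inj₁ i) (inj₂ j)  _   = ∩≡⊥ (λ x∈ x∈′ → G#H (P.⊆ground i x∈) (Q.⊆ground j x∈′))
    disjoint (inj₂ j) (inj₁ i)  _   = ∩≡⊥ (λ x∈ x∈′ → G#H (P.⊆ground i x∈′) (Q.⊆ground j x∈))
    disjoint (inj₂ j) (inj₂ j′) u≢v = Q.disjoint j j′ (λ eq → u≢v (cong inj₂ eq))
    splitAt-injective : ∀ {i j} → splitAt a i ≡ splitAt a j → i ≡ j
    splitAt-injective {i} {j} eq =
      trans (sym (join-splitAt a b i)) (trans (cong (join a b) eq) (join-splitAt a b j))

  packing⇒HasDisjoint : ∀ {G c} → Packing F G c → HasDisjoint F c
  packing⇒HasDisjoint 𝓟 = member , member-injective , member∈F , disjoint
    where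
    open Packing 𝓟
    member-injective : Injective _≡_ _≡_ member
    member-injective {i} {j} eq with i ≟ᶠ j
    ... | yes i≡j = i≡j
    ... | no  i≢j with x , x∈ ← nonempty j =
      ⊥-elim (∉⊥ (subst (x ∈ₛ_) (trans (cong (_∩ member j) (sym eq)) (disjoint i j i≢j)) (x∈p∩q⁺ (x∈ , x∈))))

0<[2+m]C2 : ∀ m → 0 < (2 + m) C 2
0<[2+m]C2 m = begin-strict
  0                      <⟨ z<s ⟩
  suc m                  ≡⟨ nC1≡n (suc m) ⟨
  suc m C 1              ≤⟨ m≤m+n _ _ ⟩
  suc m C 1 + suc m C 2  ≡⟨ nCk+nC[k+1]≡[n+1]C[k+1] (suc m) 1 ⟩
  (2 + m) C 2            ∎
  where open ≤-Reasoning

3*[1+c] : ∀ c → 3 * suc c ≡ 3 + 3 * c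
3*[1+c] = solve-∀

module _ {n} (F : Family n) where

  open Interleaving {A = Fin n} using (Interleaving)
  open Unique {A = Fin n} using (Unique)

  missingTriples-step : ∀ c v (W : List (Fin n)) → Unique (v ∷ W) → length W ≡ 3 + (2 + 3 * c) →
    (∀ R → Unique R → length R ≡ 3 * suc c → ¬ Packing F (_∈ R) (suc c) →
       (3 * suc c ∸ 1) C 2 ≤ sumChoose 3 R (missing F ∘ fromList)) →
    ¬ Packing F (_∈ v ∷ W) (suc (suc c)) → length W C 2 ≤ sumChoose 3 (v ∷ W) (missing F ∘ fromList)
  missingTriples-step c v W V!@(_ ∷ W!) |W| missingTriples-R ¬𝓟 =
    sumChoose-vertex-bound 2 r v W (missing F ∘ fromList) |W| (0<[2+m]C2 (3 * c)) bound
    where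
    r = 2 + 3 * c
    bound : ∀ {P R} → Interleaving P R W → length P ≡ 2 →
            r C 2 ≤ (r C 2) * missing F (fromList (v ∷ P)) + sumChoose 3 R (missing F ∘ fromList)
    bound {P} {R} s |P|≡2 with F (fromList (v ∷ P)) in v∪P∈F
    ... | false = ≤-trans (≤-reflexive (sym (*-identityʳ (r C 2)))) (m≤m+n _ _)
    ... | true  = begin
      r C 2                                 ≡⟨ cong (λ m → (m ∸ 1) C 2) (3*[1+c] c) ⟨
      (3 * suc c ∸ 1) C 2                   ≤⟨ missingTriples-R R (unique-interleavingʳ s W!) |R| ¬𝓟R ⟩
      sumChoose 3 R (missing F ∘ fromList)  ≤⟨ m≤n+m _ _ ⟩
      _                                     ∎
      where
      open ≤-Reasoning
      |R| : length R ≡ 3 * suc c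
      |R| = +-cancelˡ-≡ 2 (length R) _ (begin-equality
        2 + length R          ≡⟨ cong (_+ length R) |P|≡2 ⟨
        length P + length R   ≡⟨ interleave-length s ⟨
        length W              ≡⟨ |W| ⟩
        2 + (3 + 3 * c)       ≡⟨ cong (2 +_) (3*[1+c] c) ⟨
        2 + 3 * suc c         ∎)
      v∪P#R : ∀ {x} → x ∈ₛ fromList (v ∷ P) → x ∉ R
      v∪P#R x∈ x∈R with ∈-fromList⁻ (v ∷ P) x∈
      ... | here refl  = Unique[x∷xs]⇒x∉xs V! (∈-interleavingʳ s x∈R)
      ... | there x∈P = disjoint-interleaving s W! x∈P x∈R
      ⊆v∷W : ∀ {x} → x ∈ₛ fromList (v ∷ P) ⊎ x ∈ R → x ∈ v ∷ W
      ⊆v∷W (inj₁ x∈) with ∈-fromList⁻ (v ∷ P) x∈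
      ... | here x≡v  = here x≡v
      ... | there x∈P = there (∈-interleavingˡ s x∈P)
      ⊆v∷W (inj₂ x∈R) = there (∈-interleavingʳ s x∈R)
      ¬𝓟R : ¬ Packing F (_∈ R) (suc c)
      ¬𝓟R 𝓟R = ¬𝓟 (packing-weaken ⊆v∷W
        (packing-++ (packing-singleton v∪P∈F (v , ∈-fromList⁺ {L = v ∷ P} (here refl))) 𝓟R v∪P#R))

  missingTriples-lowerBound : ∀ c (V : List (Fin n)) → Unique V → length V ≡ 3 * c → ¬ Packing F (_∈ V) c →
    (3 * c ∸ 1) C 2 ≤ sumChoose 3 V (missing F ∘ fromList)
  missingTriples-lowerBound zero          V                _ _ _ = z≤n
  missingTriples-lowerBound (suc zero)    (a ∷ b ∷ d ∷ []) _ _ ¬𝓟 with F (fromList (a ∷ b ∷ d ∷ [])) in abd∈F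
  ... | true  = ⊥-elim (¬𝓟 (packing-weaken (∈-fromList⁻ (a ∷ b ∷ d ∷ []))
                  (packing-singleton abd∈F (a , ∈-fromList⁺ {L = a ∷ b ∷ d ∷ []} (here refl)))))
  ... | false = s≤s z≤n
  missingTriples-lowerBound (suc (suc c)) (v ∷ W) V! |v∷W| ¬𝓟 =
    subst (λ m → m C 2 ≤ sumChoose 3 (v ∷ W) (missing F ∘ fromList)) |W|
      (missingTriples-step c v W V! |W|≡3+r (missingTriples-lowerBound (suc c)) ¬𝓟)
    where
    |W| : length W ≡ 3 * suc (suc c) ∸ 1
    |W| = cong (_∸ 1) |v∷W|
    |W|≡3+r : length W ≡ 3 + (2 + 3 * c)
    |W|≡3+r = trans |W| (cong (_∸ 1) (trans (3*[1+c] (suc c)) (cong (3 +_) (3*[1+c] c))))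

∈-pair⁻ : ∀ {n} a b {x : Fin n} → x ∈ₛ pair a b → suc (toℕ x) ≡ a ⊎ suc (toℕ x) ≡ b
∈-pair⁻ a b {x} x∈ = ⊎-map (≡ᵇ⇒≡ _ a) (≡ᵇ⇒≡ _ b) (Equivalence.to T-∨ (Equivalence.from T-≡ x-entry))
  where
  x-entry : ((suc (toℕ x) ≡ᵇ a) ∨ (suc (toℕ x) ≡ᵇ b)) ≡ true
  x-entry = trans (sym (lookup∘tabulate _ x)) ([]=⇒lookup x∈)

∈-pair⁺ˡ : ∀ {n} a b {x : Fin n} → suc (toℕ x) ≡ a → x ∈ₛ pair a b
∈-pair⁺ˡ a b {x} eq = lookup⇒[]= x _
  (trans (lookup∘tabulate _ x) (Equivalence.to T-≡ (Equivalence.from T-∨ (inj₁ (≡⇒≡ᵇ _ a eq)))))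

-- The pair {j + 1, 2ℓ − j}, spelt as in the d = 0 clause of DCond.
mirrorPair : ∀ {n} ℓ → Fin ℓ → Subset n
mirrorPair ℓ j = pair (suc (toℕ j)) (2 * ℓ + 0 + 1 ∸ suc (toℕ j))

∈-mirrorPair⁻ : ∀ {n} ℓ j {x : Fin n} → x ∈ₛ mirrorPair ℓ j → toℕ x ≡ toℕ j ⊎ suc (toℕ x + toℕ j) ≡ 2 * ℓ
∈-mirrorPair⁻ ℓ j {x} x∈ with ∈-pair⁻ _ _ x∈
... | inj₁ x≡j    = inj₁ (suc-injective x≡j)
... | inj₂ x≡2ℓ-j = inj₂ (suc-injective (begin
  suc (suc (toℕ x + toℕ j))                  ≡⟨ cong suc (+-suc (toℕ x) (toℕ j)) ⟨
  suc (toℕ x) + suc (toℕ j)                  ≡⟨ cong (_+ suc (toℕ j)) x≡2ℓ-j ⟩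
  2 * ℓ + 0 + 1 ∸ suc (toℕ j) + suc (toℕ j)  ≡⟨ m∸n+n≡m j<2ℓ+1 ⟩
  2 * ℓ + 0 + 1                              ≡⟨ +-comm (2 * ℓ + 0) 1 ⟩
  suc (2 * ℓ + 0)                            ≡⟨ cong suc (+-identityʳ (2 * ℓ)) ⟩
  suc (2 * ℓ)                                ∎))
  where
  open ≡-Reasoning
  j<2ℓ+1 : suc (toℕ j) ≤ 2 * ℓ + 0 + 1
  j<2ℓ+1 = ≤-trans (toℕ<n j) (≤-trans (m≤m+n ℓ (ℓ + 0)) (≤-trans (m≤m+n (2 * ℓ) 0) (m≤m+n _ 1)))

mirror-sum≢ : ∀ ℓ a b → a < ℓ → b < ℓ → suc (a + b) ≢ 2 * ℓ
mirror-sum≢ ℓ a b a<ℓ b<ℓ eq = <-irrefl eq (begin-strict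
  suc (a + b)        <⟨ n<1+n _ ⟩
  suc (suc (a + b))  ≡⟨ cong suc (+-suc a b) ⟨
  suc a + suc b      ≤⟨ +-mono-≤ a<ℓ b<ℓ ⟩
  ℓ + ℓ              ≡⟨ cong (ℓ +_) (+-identityʳ ℓ) ⟨
  2 * ℓ              ∎)
  where open ≤-Reasoning

mirrorPairs-packing : ∀ {n} ℓ (F : Family n) → ℓ ≤ n → (∀ j → F (mirrorPair ℓ j) ≡ true) →
                      Packing F (λ x → toℕ x < 2 * ℓ) ℓ
mirrorPairs-packing ℓ F ℓ≤n pairs∈F = record
  { member   = mirrorPair ℓ
  ; member∈F = pairs∈F
  ; nonempty = λ j → fromℕ< (≤-trans (toℕ<n j) ℓ≤n)
                   , ∈-pair⁺ˡ _ (2 * ℓ + 0 + 1 ∸ suc (toℕ j)) (cong suc (toℕ-fromℕ< _))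
  ; disjoint = λ j j′ j≢j′ → ∩≡⊥ (λ x∈ x∈′ → j≢j′ (same j j′ (∈-mirrorPair⁻ ℓ j x∈) (∈-mirrorPair⁻ ℓ j′ x∈′)))
  ; ⊆ground  = λ j x∈ → below j (∈-mirrorPair⁻ ℓ j x∈)
  }
  where
  same : ∀ j j′ {x} → x ≡ toℕ j ⊎ suc (x + toℕ j) ≡ 2 * ℓ → x ≡ toℕ j′ ⊎ suc (x + toℕ j′) ≡ 2 * ℓ → j ≡ j′
  same j j′ (inj₁ x≡j)  (inj₁ x≡j′) = toℕ-injective (trans (sym x≡j) x≡j′)
  same j j′ (inj₁ refl) (inj₂ eq)   = ⊥-elim (mirror-sum≢ ℓ _ _ (toℕ<n j) (toℕ<n j′) eq)
  same j j′ (inj₂ eq)   (inj₁ refl) = ⊥-elim (mirror-sum≢ ℓ _ _ (toℕ<n j′) (toℕ<n j) eq)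
  same j j′ {x} (inj₂ eq) (inj₂ eq′) =
    toℕ-injective (+-cancelˡ-≡ x (toℕ j) (toℕ j′) (suc-injective (trans eq (sym eq′))))
  below : ∀ j {x} → x ≡ toℕ j ⊎ suc (x + toℕ j) ≡ 2 * ℓ → x < 2 * ℓ
  below j (inj₁ refl) = ≤-trans (toℕ<n j) (m≤m+n ℓ (ℓ + 0))
  below j (inj₂ eq)   = ≤-trans (s≤s (m≤m+n _ (toℕ j))) (≤-reflexive eq)

mirrorPairs∈F : ∀ {n} ℓ (F : Family n) → ¬ DCond ℓ F 0 → ∀ j → F (mirrorPair ℓ j) ≡ true
mirrorPairs∈F ℓ F ¬D0 j with F (mirrorPair ℓ j) in F[pair]
... | true  = refl
... | false = ⊥-elim (¬D0 (inj₁ (refl , suc (toℕ j) , s≤s z≤n , m≤n⇒m≤n+o 0 (toℕ<n j) ,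
                                 λ (_ , _ , _ , _ , pair∈F) → false≢true (trans (sym F[pair]) pair∈F))))
  where
  false≢true : false ≢ true
  false≢true ()

∈-drop-allFin : ∀ m n {x : Fin n} → x ∈ drop m (allFin n) → m ≤ toℕ x
∈-drop-allFin zero    n       _   = z≤n
∈-drop-allFin (suc m) (suc n) x∈ with ∈-map⁻ fsuc (subst (_ ∈_) drop-allFin x∈)
  where
  drop-allFin : drop (suc m) (allFin (suc n)) ≡ map fsuc (drop m (allFin n))
  drop-allFin = trans (cong (drop (suc m)) (allFin-suc n)) (drop-map m (allFin n))
... | y , y∈ , refl = s≤s (∈-drop-allFin m n y∈)

module _ {n} (ℓ : ℕ) (F : Family n) where

  inTail? : (B : Subset n) → Dec (InTail ℓ B)
  inTail? B = all? (λ k → (lookup B k ≟ᵇ true) →-dec (2 * ℓ ≤? toℕ k))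

  missingInTail : Subset n → ℕ
  missingInTail B = if does (inTail? B) then missing F B else 0

  missingInTail≤missing : ∀ B → missingInTail B ≤ missing F B
  missingInTail≤missing B with does (inTail? B)
  ... | true  = ≤-refl
  ... | false = z≤n

  tail-bound : ∀ c → n ≡ 2 * ℓ + 3 * c → (∀ j → F (mirrorPair ℓ j) ≡ true) → νLess F (ℓ + c) →
               (3 * c ∸ 1) C 2 ≤ sumBy missingInTail (threeSets n)
  tail-bound c n≡ pairs∈F ν< = begin
    (3 * c ∸ 1) C 2                                   ≤⟨ missingTriples-lowerBound F c V V! |V| ¬𝓟 ⟩
    sumChoose 3 V (missing F ∘ fromList)              ≤⟨ sumChoose-mono 3 _ _ (drop-⊆ (2 * ℓ) (allFin n)) inTail ⟩
    sumChoose 3 (allFin n) (missingInTail ∘ fromList) ≡⟨ sumBy-threeSets n missingInTail ⟨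
    sumBy missingInTail (threeSets n)                 ∎
    where
    open ≤-Reasoning
    V = drop (2 * ℓ) (allFin n)
    V! = drop⁺ (2 * ℓ) (allFin⁺ n)
    V-tail : ∀ {x} → x ∈ V → 2 * ℓ ≤ toℕ x
    V-tail = ∈-drop-allFin (2 * ℓ) n
    |V| : length V ≡ 3 * c
    |V| = trans (length-drop (2 * ℓ) (allFin n))
                (trans (cong (_∸ 2 * ℓ) (trans (length-tabulate {n = n} (λ i → i)) n≡)) (m+n∸m≡n (2 * ℓ) (3 * c)))
    ℓ≤n : ℓ ≤ n
    ℓ≤n = subst (ℓ ≤_) (sym n≡) (≤-trans (m≤m+n ℓ (ℓ + 0)) (m≤m+n (2 * ℓ) (3 * c)))
    ¬𝓟 : ¬ Packing F (_∈ V) c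
    ¬𝓟 𝓟 = ν< (packing⇒HasDisjoint (packing-++ (mirrorPairs-packing ℓ F ℓ≤n pairs∈F) 𝓟
                 (λ x<2ℓ x∈V → <⇒≱ x<2ℓ (V-tail x∈V))))
    inTail : ∀ {T} → T ⊆ V → missing F (fromList T) ≤ missingInTail (fromList T)
    inTail {T} T⊆V rewrite dec-true (inTail? (fromList T))
      (λ k k∈ → V-tail (Any-resp-⊆ T⊆V (∈-fromList⁻ T (lookup⇒[]= k (fromList T) k∈)))) = ≤-refl

  tail≤y3 : sumBy missingInTail (threeSets n) ≤ y3 F
  tail≤y3 = ≤-trans (sumBy-mono _ _ (threeSets n) missingInTail≤missing) (≤-reflexive (sym (y3≡sumBy F)))

  y3≤tail⇒∈F : y3 F ≤ sumBy missingInTail (threeSets n) → ∀ A → Is3 A → ¬ InTail ℓ A → F A ≡ true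
  y3≤tail⇒∈F y3≤tail A |A|≡3 A∉tail with F A in F[A]
  ... | true  = refl
  ... | false = ⊥-elim (<⇒≱ (sumBy-mono-< missingInTail (missing F) A∈threeSets missingInTail≤missing A-counted)
                            (≤-trans (≤-reflexive (sym (y3≡sumBy F))) y3≤tail))
    where
    A∈threeSets : A ∈ threeSets n
    A∈threeSets = ∈-filter⁺ (λ B → ∣ B ∣ ≟ 3) (∈-allSubsets A) |A|≡3
    A-counted : missingInTail A < missing F A
    A-counted rewrite dec-false (inTail? A) A∉tail | F[A] = s≤s z≤n

lemma17 : (n s ℓ c : ℕ) → 1 ≤ s → n ≡ 2 * s + c → n + ℓ ≡ 3 * s →
          1 ≤ c → c ≤ s ∸ 1 → 1 ≤ ℓ → ℓ ≤ s ∸ 1 →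
          (F : Family n) →
          (∃[ d ] (IsD ℓ F d × 0 < d)) → νLess F s →
          (y3 F ≥ (3 * c ∸ 1) C 2)
          × (y3 F ≡ (3 * c ∸ 1) C 2 →
               ∀ (A : Subset n) → Is3 A → ¬ InTail ℓ A → F A ≡ true)
lemma17 n s ℓ c _ n≡2s+c n+ℓ≡3s _ _ _ _ F (d , (_ , d-minimal) , 0<d) ν<s =
  ≤-trans bound (tail≤y3 ℓ F) , λ y3≡ → y3≤tail⇒∈F ℓ F (≤-trans (≤-reflexive y3≡) bound)
  where
  ℓ+c≡s : ℓ + c ≡ s
  ℓ+c≡s = +-cancelˡ-≡ (2 * s) _ _ (begin
    2 * s + (ℓ + c)  ≡⟨ cong (2 * s +_) (+-comm ℓ c) ⟩
    2 * s + (c + ℓ)  ≡⟨ +-assoc (2 * s) c ℓ ⟨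
    2 * s + c + ℓ    ≡⟨ cong (_+ ℓ) n≡2s+c ⟨
    n + ℓ            ≡⟨ n+ℓ≡3s ⟩
    3 * s            ≡⟨ 3s≡2s+s s ⟩
    2 * s + s        ∎)
    where
    open ≡-Reasoning
    3s≡2s+s : ∀ s → 3 * s ≡ 2 * s + s
    3s≡2s+s = solve-∀
  n≡2ℓ+3c : n ≡ 2 * ℓ + 3 * c
  n≡2ℓ+3c = trans n≡2s+c (subst (λ s → 2 * s + c ≡ 2 * ℓ + 3 * c) ℓ+c≡s (regroup ℓ c))
    where
    regroup : ∀ ℓ c → 2 * (ℓ + c) + c ≡ 2 * ℓ + 3 * c
    regroup = solve-∀
  bound : (3 * c ∸ 1) C 2 ≤ sumBy (missingInTail ℓ F) (threeSets n)
  bound = tail-bound ℓ F c n≡2ℓ+3c (mirrorPairs∈F ℓ F (d-minimal 0 0<d)) (ν<s ∘ subst (HasDisjoint F) ℓ+c≡s)
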